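{- Identify the graded dual $\mathcal{A}^{\circledast}=\bigoplus_n\mathcal{A}_n^*$ with $\mathcal{A}$ via the pairing $\langle t,s\rangle=\delta_{t,s}$ on reduced trees, and let $\Delta$, $\Delta_\prec$, $\Delta_\bullet$, $\Delta_\succ$ be the maps on $\mathcal{A}^{\circledast}$ dual to $*,\prec,\cdot,\succ$. Then for every reduced tree $t\neq|$ with $n+1$ leaves, $$\Delta(t)=\sum_{m=1}^{n+1}{}^{m}t\otimes t^{m},$$ and $\Delta_\prec(t)$ (resp. $\Delta_\succ(t)$, resp. $\Delta_\bullet(t)$) is the sum of the terms ${}^mt\otimes t^m$ over those $m$ for which the path from the root of $t$ to its $m$-th leaf leaves the root through its last child (resp. through its first child, resp. through neither its first nor its last child).
   Context: A reduced tree is a planar rooted tree whose internal vertices all have at least two children; $|$ is the tree with one leaf and no internal vertex. $T_n$ = reduced trees with $n+1$ leaves, $\mathcal{A}_n=\mathbb{K}T_n$, $\mathcal{A}=\bigoplus_{n\ge0}\mathcal{A}_n$, $\mathcal{A}^+=\bigoplus_{n\ge1}\mathcal{A}_n$. $x^{(0)}\vee\cdots\vee x^{(k)}$ ($k\ge1$) grafts trees left to right on a new root (multilinear). Recursively, for $x=x^{(0)}\vee\cdots\vee x^{(k)}$, $y=y^{(0)}\vee\cdots\vee y^{(l)}$: $x\prec y=x^{(0)}\vee\cdots\vee x^{(k-1)}\vee(x^{(k)}*y)$, $x\cdot y=x^{(0)}\vee\cdots\vee x^{(k-1)}\vee(x^{(k)}*y^{(0)})\vee y^{(1)}\vee\cdots\vee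 y^{(l)}$, $x\succ y=(x*y^{(0)})\vee y^{(1)}\vee\cdots\vee y^{(l)}$, $*=\prec+\cdot+\succ$, $|$ a unit for $*$, and for $a\in\mathcal{A}^+$: $|\prec a=0$, $a\prec|=a$, $|\succ a=a$, $a\succ|=0$, $|\cdot a=a\cdot|=0$. Dual maps: for $t\in\mathcal{A}^+$, $\Delta(t)$ is defined by $\langle\Delta(t),u\otimes v\rangle=\langle t,u*v\rangle$ for all trees $u,v$, and for $\ltimes\in\{\prec,\cdot,\succ\}$ (with $\Delta_\bullet$ dual to $\cdot$), $\langle\Delta_\ltimes(t),u\otimes v\rangle=\langle t,u\ltimes v\rangle$ for all trees $u,v$ not both equal to $|$; so $\Delta=\Delta_\prec+\Delta_\bullet+\Delta_\succ$ on $\mathcal{A}^+$. Lightening: for a tree $t$ with leaves numbered $1,\dots,n+1$ from left to right and $m\in\{1,\dots,n+1\}$, let $p$ be the path from the root to leaf $m$. ${}^mt$ is obtained from $t$ by deleting, at every vertex of $p$, all children (with their descendants) lying strictly to the right of $p$, and then suppressing every vertex left with exactly one child (merging its two edges); $t^m$ is obtained in the same way deleting everything strictly to the left of $p$. Thus ${}^mt$ has $m$ leaves and $t^m$ has $n+2-m$ leaves. -}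

module Defs where

open import Data.Nat using (ℕ; zero; suc; _+_; _∸_; _≤ᵇ_)
open import Data.Bool using (if_then_else_)
open import Data.List using (List; []; _∷_; _++_; map; filter; length; upTo)
open import Data.Product using (_×_; _,_)
open import Relation.Nullary using (Dec; yes; no; ¬_)
open import Relation.Nullary.Decidable using (_×-dec_)
open import Relation.Binary.PropositionalEquality using (_≡_; refl)
open import Relation.Binary.Definitions using (DecidableEquality)

-- Reduced planar rooted trees.
-- `leaf` is the tree | .  `node a ms z` is the tree whose root has the
-- children a, ms (in order), z ; i.e. a ∨ m₁ ∨ … ∨ mⱼ ∨ z.  Every
-- internal vertex therefore has ≥ 2 children, and each reduced tree has
-- exactly one representation.

data Tree : Set where
  leaf : Tree
  node : Tree → List Tree → Tree → Tree

mutual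
  _≟T_ : DecidableEquality Tree
  leaf ≟T leaf = yes refl
  leaf ≟T node _ _ _ = no (λ ())
  node _ _ _ ≟T leaf = no (λ ())
  node a ms z ≟T node b ns w with a ≟T b | ms ≟L ns | z ≟T w
  ... | yes refl | yes refl | yes refl = yes refl
  ... | no p | _ | _ = no (λ { refl → p refl })
  ... | yes _ | no p | _ = no (λ { refl → p refl })
  ... | yes _ | yes _ | no p = no (λ { refl → p refl })

  _≟L_ : DecidableEquality (List Tree)
  [] ≟L [] = yes refl
  [] ≟L (_ ∷ _) = no (λ ())
  (_ ∷ _) ≟L [] = no (λ ())
  (a ∷ as) ≟L (b ∷ bs) with a ≟T b | as ≟L bs
  ... | yes refl | yes refl = yes refl
  ... | no p | _ = no (λ { refl → p refl })
  ... | yes _ | no p = no (λ { refl → p refl })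

-- Elements of 𝒜 with non-negative integer coefficients are represented
-- as finite multisets (lists) of trees; the sum of two elements is _++_.
-- ⟨ t , xs ⟩ : coefficient of the tree t in xs (pairing ⟨t,s⟩ = δ_{t,s}).

⟨_,_⟩ : Tree → List Tree → ℕ
⟨ t , xs ⟩ = length (filter (t ≟T_) xs)

-- The cases | ≺ |, | • |, | ≻ | are not defined in the paper; they are
-- set to 0 here and never used by the statement.

infixl 7 _⋆_ _≺_ _•_ _≻_

mutual
  _⋆_ : Tree → Tree → List Tree
  leaf ⋆ y = y ∷ []
  x@(node _ _ _) ⋆ leaf = x ∷ []
  x@(node _ _ _) ⋆ y@(node _ _ _) = (x ≺ y) ++ (x • y) ++ (x ≻ y)

  _≺_ : Tree → Tree → List Tree
  leaf ≺ _ = []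
  x@(node _ _ _) ≺ leaf = x ∷ []
  node a ms z ≺ y@(node _ _ _) = map (λ s → node a ms s) (z ⋆ y)

  _•_ : Tree → Tree → List Tree
  leaf • _ = []
  node _ _ _ • leaf = []
  node a ms z • node b ns w = map (λ s → node a (ms ++ s ∷ ns) w) (z ⋆ b)

  _≻_ : Tree → Tree → List Tree
  _ ≻ leaf = []
  leaf ≻ y@(node _ _ _) = y ∷ []
  x@(node _ _ _) ≻ node b ns w = map (λ s → node s ns w) (x ⋆ b)

mutual
  leaves : Tree → ℕ
  leaves leaf = 1
  leaves (node a ms z) = leaves a + leavesL ms + leaves z

  leavesL : List Tree → ℕ
  leavesL [] = 0
  leavesL (c ∷ cs) = leaves c + leavesL cs

-- Lightenings (leaves numbered 1,…,leaves t from left to right).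
-- lightL m t = ᵐt : delete everything strictly right of the path to leaf m,
--                   then suppress unary vertices.
-- lightR m t = tᵐ : same, deleting everything strictly to the left.

mutual
  lightL : ℕ → Tree → Tree
  lightL m leaf = leaf
  lightL m (node a ms z) =
    if m ≤ᵇ leaves a then lightL m a           -- only child left: suppressed
    else lightLMid a [] (m ∸ leaves a) ms z

  -- a : first child, acc : middle children already passed (kept)
  lightLMid : Tree → List Tree → ℕ → List Tree → Tree → Tree
  lightLMid a acc m [] z = node a acc (lightL m z)
  lightLMid a acc m (c ∷ cs) z =
    if m ≤ᵇ leaves c then node a acc (lightL m c)
    else lightLMid a (acc ++ c ∷ []) (m ∸ leaves c) cs z

mutual
  lightR : ℕ → Tree → Tree
  lightR m leaf = leaf
  lightR m (node a ms z) =
    if m ≤ᵇ leaves a then node (lightR m a) ms z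
    else lightRMid (m ∸ leaves a) ms z

  lightRMid : ℕ → List Tree → Tree → Tree
  lightRMid m [] z = lightR m z                 -- only child left: suppressed
  lightRMid m (c ∷ cs) z =
    if m ≤ᵇ leaves c then node (lightR m c) cs z
    else lightRMid (m ∸ leaves c) cs z

-- Through which child of the root the path to leaf m leaves the root.

data Side : Set where
  firstChild middleChild lastChild : Side

_≟S_ : DecidableEquality Side
firstChild ≟S firstChild = yes refl
firstChild ≟S middleChild = no (λ ())
firstChild ≟S lastChild = no (λ ())
middleChild ≟S firstChild = no (λ ())
middleChild ≟S middleChild = yes refl
middleChild ≟S lastChild = no (λ ())
lastChild ≟S firstChild = no (λ ())
lastChild ≟S middleChild = no (λ ())
lastChild ≟S lastChild = yes refl

rootSideMid : ℕ → List Tree → Side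
rootSideMid m [] = lastChild
rootSideMid m (c ∷ cs) = if m ≤ᵇ leaves c then middleChild else rootSideMid (m ∸ leaves c) cs

-- (the value for `leaf` is irrelevant: the root of | has no children)
rootSide : ℕ → Tree → Side
rootSide m leaf = middleChild
rootSide m (node a ms z) =
  if m ≤ᵇ leaves a then firstChild else rootSideMid (m ∸ leaves a) ms

-- Coefficients of u ⊗ v in  Σ_{m=1}^{n+1} ᵐt ⊗ tᵐ  and in the partial
-- sums restricted to the m whose path leaves the root through side s.

leafIndices : Tree → List ℕ
leafIndices t = map suc (upTo (leaves t))

lightCoeff : Tree → Tree → Tree → ℕ
lightCoeff t u v =
  length (filter {P = λ m → (lightL m t ≡ u) × (lightR m t ≡ v)}
                 (λ m → (lightL m t ≟T u) ×-dec (lightR m t ≟T v))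
                 (leafIndices t))

lightCoeffSide : Side → Tree → Tree → Tree → ℕ
lightCoeffSide s t u v =
  length (filter {P = λ m → ((lightL m t ≡ u) × (lightR m t ≡ v)) × (rootSide m t ≡ s)}
                 (λ m → ((lightL m t ≟T u) ×-dec (lightR m t ≟T v)) ×-dec (rootSide m t ≟S s))
                 (leafIndices t))

-- Write t = a ∨ m₁ ∨ ⋯ ∨ mⱼ ∨ z.  Its lightenings fall into three blocks according to the child
-- through which the path to the leaf leaves the root: (ᵏa , aᵏ ∨ m₁ ∨ ⋯ ∨ z) through a,
-- (a ∨ m₁ ∨ ⋯ ∨ mᵢ₋₁ ∨ ᵏmᵢ , mᵢᵏ ∨ mᵢ₊₁ ∨ ⋯ ∨ z) through mᵢ, and (a ∨ m₁ ∨ ⋯ ∨ mⱼ ∨ ᵏz , zᵏ)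
-- through z.  Dually, t occurs in u ≻ v, u · v or u ≺ v only if the grafting of the recursive
-- definition rebuilds the shape of t around a, mᵢ or z, and then its coefficient is that of this
-- child c in a product x * y of strictly smaller trees.  By induction on t, that coefficient counts
-- the lightenings of c equal to (x , y), which correspond exactly to the lightenings of t in the
-- matching block equal to (u , v).  Adding the three blocks gives the formula for Δ.

module Submission where

open import Defs
open import Data.Product using (_×_)
open import Relation.Nullary using (¬_)
open import Relation.Binary.PropositionalEquality using (_≡_; _≢_)

open import Data.Bool using (true; false)
open import Data.Bool.Properties using (T-≡)
open import Data.Empty using (⊥-elim)
open import Data.List using (List; []; _∷_; _++_; map; filter; length; upTo; applyUpTo)
open import Data.List.Properties
  using (filter-++; filter-none; length-++; map-++; map-∘; map-id; map-upTo; map-applyUpTo)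
open import Data.List.Relation.Unary.All using (All; []; _∷_; universal) renaming (map to All-map)
open import Data.List.Relation.Unary.All.Properties using (map⁺; ++⁺)
open import Data.Nat using (ℕ; zero; suc; _+_; _∸_; _≤ᵇ_; _≤_; _<_; z≤n; s≤s)
open import Data.Nat.Properties using (≤⇒≤ᵇ; +-assoc; +-comm; +-identityʳ)
open import Data.Product using (_,_; proj₁; proj₂; map₁; map₂)
open import Data.Product.Properties using (≡-dec; ×-≡,≡→≡)
open import Function using (_∘_; _⇔_; mk⇔; Equivalence)
open import Function.Definitions using (Injective)
open import Relation.Nullary using (yes; no)
open import Relation.Unary using (Decidable)
open import Relation.Binary.Definitions using (DecidableEquality)
open import Relation.Binary.PropositionalEquality using (refl; sym; trans; cong; cong₂; module ≡-Reasoning)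

open ≡-Reasoning

module _ {A : Set} (_≟_ : DecidableEquality A) where

  multiplicity : A → List A → ℕ
  multiplicity x xs = length (filter (x ≟_) xs)

  multiplicity-++ : ∀ x xs ys → multiplicity x (xs ++ ys) ≡ multiplicity x xs + multiplicity x ys
  multiplicity-++ x xs ys = trans (cong length (filter-++ (x ≟_) xs ys)) (length-++ (filter (x ≟_) xs))

  multiplicity-++³ : ∀ x xs ys zs →
    multiplicity x (xs ++ ys ++ zs) ≡ multiplicity x xs + (multiplicity x ys + multiplicity x zs)
  multiplicity-++³ x xs ys zs =
    trans (multiplicity-++ x xs (ys ++ zs)) (cong (multiplicity x xs +_) (multiplicity-++ x ys zs))

  multiplicity-∉ : ∀ {x xs} → All (x ≢_) xs → multiplicity x xs ≡ 0
  multiplicity-∉ {x} x∉xs = cong length (filter-none (x ≟_) x∉xs)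

multiplicity-map-∉ : ∀ {A B : Set} (_≟_ : DecidableEquality B) (f : A → B) xs {y} →
  (∀ x → y ≢ f x) → multiplicity _≟_ y (map f xs) ≡ 0
multiplicity-map-∉ _≟_ f xs y∉f = multiplicity-∉ _≟_ (map⁺ (universal y∉f xs))

multiplicity-map-injective : ∀ {A B : Set} (_≟A_ : DecidableEquality A) (_≟B_ : DecidableEquality B)
  {f : A → B} → Injective _≡_ _≡_ f → ∀ x xs → multiplicity _≟B_ (f x) (map f xs) ≡ multiplicity _≟A_ x xs
multiplicity-map-injective _≟A_ _≟B_ f-inj x [] = refl
multiplicity-map-injective _≟A_ _≟B_ {f} f-inj x (y ∷ ys) with f x ≟B f y | x ≟A y
... | yes _     | yes _   = cong suc (multiplicity-map-injective _≟A_ _≟B_ f-inj x ys)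
... | no _      | no _    = multiplicity-map-injective _≟A_ _≟B_ f-inj x ys
... | yes fx≡fy | no x≢y  = ⊥-elim (x≢y (f-inj fx≡fy))
... | no fx≢fy  | yes x≡y = ⊥-elim (fx≢fy (cong f x≡y))

length-filter-map : ∀ {A B : Set} {P : A → Set} {Q : B → Set} (P? : Decidable P) (Q? : Decidable Q)
  (f : A → B) → (∀ x → P x ⇔ Q (f x)) → ∀ xs → length (filter P? xs) ≡ length (filter Q? (map f xs))
length-filter-map P? Q? f P⇔Qf [] = refl
length-filter-map P? Q? f P⇔Qf (x ∷ xs) with P? x | Q? (f x)
... | yes _  | yes _  = cong suc (length-filter-map P? Q? f P⇔Qf xs)
... | no _   | no _   = length-filter-map P? Q? f P⇔Qf xs
... | yes p  | no ¬q  = ⊥-elim (¬q (Equivalence.to (P⇔Qf x) p))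
... | no ¬p  | yes q  = ⊥-elim (¬p (Equivalence.from (P⇔Qf x) q))

applyUpTo-+ : ∀ {A : Set} (f : ℕ → A) m n → applyUpTo f (m + n) ≡ applyUpTo f m ++ applyUpTo (f ∘ (m +_)) n
applyUpTo-+ f zero    n = refl
applyUpTo-+ f (suc m) n = cong (f 0 ∷_) (applyUpTo-+ (f ∘ suc) m n)

applyUpTo-cong : ∀ {A : Set} {f g : ℕ → A} n → (∀ {i} → i < n → f i ≡ g i) → applyUpTo f n ≡ applyUpTo g n
applyUpTo-cong zero    f≡g = refl
applyUpTo-cong (suc n) f≡g = cong₂ _∷_ (f≡g (s≤s z≤n)) (applyUpTo-cong n (λ i<n → f≡g (s≤s i<n)))

map²-applyUpTo : ∀ {A B C : Set} (f : ℕ → A) (g : A → B) (h : B → C) n →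
  map h (map g (applyUpTo f n)) ≡ applyUpTo (h ∘ g ∘ f) n
map²-applyUpTo f g h n = trans (cong (map h) (map-applyUpTo f g n)) (map-applyUpTo (g ∘ f) h n)

≤⇒≤ᵇ≡true : ∀ {m n} → m ≤ n → (m ≤ᵇ n) ≡ true
≤⇒≤ᵇ≡true m≤n = Equivalence.to T-≡ (≤⇒≤ᵇ m≤n)

suc[m+n]≤ᵇm≡false : ∀ m n → (suc (m + n) ≤ᵇ m) ≡ false
suc[m+n]≤ᵇm≡false zero    n = refl
suc[m+n]≤ᵇm≡false (suc m) n = suc[m+n]≤ᵇm≡false m n

suc[m+n]∸m≡suc[n] : ∀ m n → suc (m + n) ∸ m ≡ suc n
suc[m+n]∸m≡suc[n] zero    n = refl
suc[m+n]∸m≡suc[n] (suc m) n = suc[m+n]∸m≡suc[n] m n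

Lightening : Set
Lightening = Tree × Tree

_≟Λ_ : DecidableEquality Lightening
_≟Λ_ = ≡-dec _≟T_ _≟T_

-- Defs' ⟨ t , xs ⟩ is definitionally multiplicity _≟T_ t xs.
⟪_,_⟫ : Lightening → List Lightening → ℕ
⟪_,_⟫ = multiplicity _≟Λ_

SidedLightening : Set
SidedLightening = Side × Lightening

_≟ΣΛ_ : DecidableEquality SidedLightening
_≟ΣΛ_ = ≡-dec _≟S_ _≟Λ_

lightening : Tree → ℕ → Lightening
lightening t m = lightL m t , lightR m t

sidedLightening : Tree → ℕ → SidedLightening
sidedLightening t m = rootSide m t , lightening t m

lightenings : Tree → List Lightening
lightenings t = applyUpTo (lightening t ∘ suc) (leaves t)

sidedLightenings : Tree → List SidedLightening
sidedLightenings t = applyUpTo (sidedLightening t ∘ suc) (leaves t)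

tag : Side → Lightening → SidedLightening
tag s p = s , p

tagged : Side → List Lightening → List SidedLightening
tagged s = map (tag s)

consMiddle : Tree → Tree → Tree
consMiddle c leaf          = leaf
consMiddle c (node a ms z) = node a (c ∷ ms) z

consMiddle-injective : ∀ c → Injective _≡_ _≡_ (consMiddle c)
consMiddle-injective c {leaf}       {leaf}       refl = refl
consMiddle-injective c {node _ _ _} {node _ _ _} refl = refl

map₁-consMiddle-injective : ∀ c → Injective _≡_ _≡_ (map₁ {B = Tree} {C = Tree} (consMiddle c))
map₁-consMiddle-injective c eq = ×-≡,≡→≡ (consMiddle-injective c (cong proj₁ eq) , cong proj₂ eq)

consMiddle-≢leaf : ∀ c {t} → t ≢ leaf → consMiddle c t ≢ leaf
consMiddle-≢leaf c {leaf}       t≢leaf = t≢leaf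
consMiddle-≢leaf c {node _ _ _} _      = λ ()

graftFirst : List Tree → Tree → Lightening → Lightening
graftFirst ms z (L , R) = L , node R ms z

graftMiddle : Tree → List Tree → Tree → Lightening → Lightening
graftMiddle a cs z (L , R) = node a [] L , node R cs z

graftLast : Tree → List Tree → Lightening → Lightening
graftLast a ms (L , R) = node a ms L , R

firstLightenings : Tree → List Tree → Tree → List Lightening
firstLightenings a ms z = map (graftFirst ms z) (lightenings a)

-- A path through the middle child c keeps the middle children before c in the left
-- lightening (they are pushed on by consMiddle) and those after c in the right one.
middleLightenings : Tree → List Tree → Tree → List Lightening
middleLightenings a []       z = []
middleLightenings a (c ∷ cs) z =
  map (graftMiddle a cs z) (lightenings c) ++ map (map₁ (consMiddle c)) (middleLightenings a cs z)

lastLightenings : Tree → List Tree → Tree → List Lightening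
lastLightenings a ms z = map (graftLast a ms) (lightenings z)

lighteningsThrough : Side → Tree → List Tree → Tree → List Lightening
lighteningsThrough firstChild  = firstLightenings
lighteningsThrough middleChild = middleLightenings
lighteningsThrough lastChild   = lastLightenings

middleLightenings-nonLeaf : ∀ a cs z →
  All (λ p → proj₁ p ≢ leaf × proj₂ p ≢ leaf) (middleLightenings a cs z)
middleLightenings-nonLeaf a []       z = []
middleLightenings-nonLeaf a (c ∷ cs) z =
  ++⁺ (map⁺ (universal (λ { (L , R) → (λ ()) , (λ ()) }) (lightenings c)))
      (map⁺ (All-map (λ (L≢leaf , R≢leaf) → consMiddle-≢leaf c L≢leaf , R≢leaf) (middleLightenings-nonLeaf a cs z)))

sidedLighteningMid : Tree → List Tree → Tree → ℕ → SidedLightening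
sidedLighteningMid a ms z k = rootSideMid k ms , lightLMid a [] k ms z , lightRMid k ms z

lightLMid-consMiddle : ∀ a c acc k cs z → lightLMid a (c ∷ acc) k cs z ≡ consMiddle c (lightLMid a acc k cs z)
lightLMid-consMiddle a c acc k []        z = refl
lightLMid-consMiddle a c acc k (c′ ∷ cs) z with k ≤ᵇ leaves c′
... | true  = refl
... | false = lightLMid-consMiddle a c (acc ++ c′ ∷ []) (k ∸ leaves c′) cs z

sidedLightening-first : ∀ a ms z m → m ≤ leaves a →
  sidedLightening (node a ms z) m ≡ (firstChild , graftFirst ms z (lightening a m))
sidedLightening-first a ms z m m≤a rewrite ≤⇒≤ᵇ≡true m≤a = refl

sidedLightening-pastFirst : ∀ a ms z j →
  sidedLightening (node a ms z) (suc (leaves a + j)) ≡ sidedLighteningMid a ms z (suc j)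
sidedLightening-pastFirst a ms z j
  rewrite suc[m+n]≤ᵇm≡false (leaves a) j | suc[m+n]∸m≡suc[n] (leaves a) j = refl

sidedLighteningMid-here : ∀ a c cs z k → k ≤ leaves c →
  sidedLighteningMid a (c ∷ cs) z k ≡ (middleChild , graftMiddle a cs z (lightening c k))
sidedLighteningMid-here a c cs z k k≤c rewrite ≤⇒≤ᵇ≡true k≤c = refl

sidedLighteningMid-skip : ∀ a c cs z j →
  sidedLighteningMid a (c ∷ cs) z (suc (leaves c + j)) ≡ map₂ (map₁ (consMiddle c)) (sidedLighteningMid a cs z (suc j))
sidedLighteningMid-skip a c cs z j
  rewrite suc[m+n]≤ᵇm≡false (leaves c) j | suc[m+n]∸m≡suc[n] (leaves c) j =
  cong (λ L → rootSideMid (suc j) cs , L , lightRMid (suc j) cs z) (lightLMid-consMiddle a c [] (suc j) cs z)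

sidedLighteningMid-last : ∀ a ms z j →
  sidedLighteningMid a ms z (suc (leavesL ms + j)) ≡ (lastChild , graftLast a ms (lightening z (suc j)))
sidedLighteningMid-last a []       z j = refl
sidedLighteningMid-last a (c ∷ cs) z j = begin
  sidedLighteningMid a (c ∷ cs) z (suc (leaves c + leavesL cs + j))
    ≡⟨ cong (sidedLighteningMid a (c ∷ cs) z ∘ suc) (+-assoc (leaves c) (leavesL cs) j) ⟩
  sidedLighteningMid a (c ∷ cs) z (suc (leaves c + (leavesL cs + j)))
    ≡⟨ sidedLighteningMid-skip a c cs z (leavesL cs + j) ⟩
  map₂ (map₁ (consMiddle c)) (sidedLighteningMid a cs z (suc (leavesL cs + j)))
    ≡⟨ cong (map₂ (map₁ (consMiddle c))) (sidedLighteningMid-last a cs z j) ⟩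
  (lastChild , graftLast a (c ∷ cs) (lightening z (suc j)))
    ∎

sidedLighteningsMid-middle : ∀ a ms z →
  applyUpTo (sidedLighteningMid a ms z ∘ suc) (leavesL ms) ≡ tagged middleChild (middleLightenings a ms z)
sidedLighteningsMid-middle a []       z = refl
sidedLighteningsMid-middle a (c ∷ cs) z = begin
  applyUpTo g (leaves c + leavesL cs)
    ≡⟨ applyUpTo-+ g (leaves c) (leavesL cs) ⟩
  applyUpTo g (leaves c) ++ applyUpTo (g ∘ (leaves c +_)) (leavesL cs)
    ≡⟨ cong₂ _++_ (applyUpTo-cong (leaves c) (λ i<c → sidedLighteningMid-here a c cs z _ i<c))
                  (applyUpTo-cong (leavesL cs) (λ {j} _ → sidedLighteningMid-skip a c cs z j)) ⟩
  applyUpTo (tag middleChild ∘ graftMiddle a cs z ∘ lightening c ∘ suc) (leaves c)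
    ++ applyUpTo (map₂ (map₁ (consMiddle c)) ∘ sidedLighteningMid a cs z ∘ suc) (leavesL cs)
    ≡⟨ cong₂ _++_ (sym (map²-applyUpTo _ _ _ (leaves c)))
                  (sym (map-applyUpTo (sidedLighteningMid a cs z ∘ suc) _ (leavesL cs))) ⟩
  tagged middleChild (map (graftMiddle a cs z) (lightenings c))
    ++ map (map₂ (map₁ (consMiddle c))) (applyUpTo (sidedLighteningMid a cs z ∘ suc) (leavesL cs))
    ≡⟨ cong (λ xs → tagged middleChild (map (graftMiddle a cs z) (lightenings c)) ++ map (map₂ (map₁ (consMiddle c))) xs)
            (sidedLighteningsMid-middle a cs z) ⟩
  tagged middleChild (map (graftMiddle a cs z) (lightenings c))
    ++ map (map₂ (map₁ (consMiddle c))) (tagged middleChild (middleLightenings a cs z))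
    ≡⟨ cong (tagged middleChild (map (graftMiddle a cs z) (lightenings c)) ++_)
            (trans (sym (map-∘ (middleLightenings a cs z))) (map-∘ (middleLightenings a cs z))) ⟩
  tagged middleChild (map (graftMiddle a cs z) (lightenings c))
    ++ tagged middleChild (map (map₁ (consMiddle c)) (middleLightenings a cs z))
    ≡⟨ sym (map-++ (tag middleChild) (map (graftMiddle a cs z) (lightenings c))
                   (map (map₁ (consMiddle c)) (middleLightenings a cs z))) ⟩
  tagged middleChild (middleLightenings a (c ∷ cs) z)
    ∎
  where
  g : ℕ → SidedLightening
  g = sidedLighteningMid a (c ∷ cs) z ∘ suc

sidedLightenings-node : ∀ a ms z → sidedLightenings (node a ms z) ≡
  tagged firstChild (firstLightenings a ms z) ++ tagged middleChild (middleLightenings a ms z)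
    ++ tagged lastChild (lastLightenings a ms z)
sidedLightenings-node a ms z = begin
  applyUpTo f (leaves a + leavesL ms + leaves z)
    ≡⟨ cong (applyUpTo f) (+-assoc (leaves a) (leavesL ms) (leaves z)) ⟩
  applyUpTo f (leaves a + (leavesL ms + leaves z))
    ≡⟨ applyUpTo-+ f (leaves a) (leavesL ms + leaves z) ⟩
  applyUpTo f (leaves a) ++ applyUpTo (f ∘ (leaves a +_)) (leavesL ms + leaves z)
    ≡⟨ cong₂ _++_ (applyUpTo-cong (leaves a) (λ i<a → sidedLightening-first a ms z _ i<a))
                  (applyUpTo-cong (leavesL ms + leaves z) (λ {j} _ → sidedLightening-pastFirst a ms z j)) ⟩
  applyUpTo (tag firstChild ∘ graftFirst ms z ∘ lightening a ∘ suc) (leaves a)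
    ++ applyUpTo g (leavesL ms + leaves z)
    ≡⟨ cong₂ _++_ (sym (map²-applyUpTo _ _ _ (leaves a))) (applyUpTo-+ g (leavesL ms) (leaves z)) ⟩
  tagged firstChild (firstLightenings a ms z)
    ++ applyUpTo g (leavesL ms) ++ applyUpTo (g ∘ (leavesL ms +_)) (leaves z)
    ≡⟨ cong (λ xs → tagged firstChild (firstLightenings a ms z) ++ applyUpTo g (leavesL ms) ++ xs)
            (applyUpTo-cong (leaves z) (λ {j} _ → sidedLighteningMid-last a ms z j)) ⟩
  tagged firstChild (firstLightenings a ms z)
    ++ applyUpTo g (leavesL ms) ++ applyUpTo (tag lastChild ∘ graftLast a ms ∘ lightening z ∘ suc) (leaves z)
    ≡⟨ cong (tagged firstChild (firstLightenings a ms z) ++_)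
            (cong₂ _++_ (sidedLighteningsMid-middle a ms z) (sym (map²-applyUpTo _ _ _ (leaves z)))) ⟩
  tagged firstChild (firstLightenings a ms z) ++ tagged middleChild (middleLightenings a ms z)
    ++ tagged lastChild (lastLightenings a ms z)
    ∎
  where
  f : ℕ → SidedLightening
  f = sidedLightening (node a ms z) ∘ suc
  g : ℕ → SidedLightening
  g = sidedLighteningMid a ms z ∘ suc

lightenings-node : ∀ a ms z →
  lightenings (node a ms z) ≡ firstLightenings a ms z ++ middleLightenings a ms z ++ lastLightenings a ms z
lightenings-node a ms z = begin
  lightenings (node a ms z)
    ≡⟨ sym (map-applyUpTo _ proj₂ (leaves (node a ms z))) ⟩
  map proj₂ (sidedLightenings (node a ms z))
    ≡⟨ cong (map proj₂) (sidedLightenings-node a ms z) ⟩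
  map proj₂ (tagged firstChild F ++ tagged middleChild M ++ tagged lastChild L)
    ≡⟨ trans (map-++ proj₂ (tagged firstChild F) _)
             (cong (map proj₂ (tagged firstChild F) ++_) (map-++ proj₂ (tagged middleChild M) (tagged lastChild L))) ⟩
  map proj₂ (tagged firstChild F) ++ map proj₂ (tagged middleChild M) ++ map proj₂ (tagged lastChild L)
    ≡⟨ cong₂ _++_ (untag firstChild F) (cong₂ _++_ (untag middleChild M) (untag lastChild L)) ⟩
  F ++ M ++ L
    ∎
  where
  F = firstLightenings a ms z
  M = middleLightenings a ms z
  L = lastLightenings a ms z
  untag : ∀ s xs → map proj₂ (tagged s xs) ≡ xs
  untag s xs = trans (sym (map-∘ xs)) (map-id xs)

multiplicity-tagged-hit : ∀ s p xs → multiplicity _≟ΣΛ_ (s , p) (tagged s xs) ≡ ⟪ p , xs ⟫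
multiplicity-tagged-hit s = multiplicity-map-injective _≟Λ_ _≟ΣΛ_ (λ { refl → refl })

multiplicity-tagged-miss : ∀ {s s′} → s ≢ s′ → ∀ p xs → multiplicity _≟ΣΛ_ (s , p) (tagged s′ xs) ≡ 0
multiplicity-tagged-miss {s′ = s′} s≢s′ p xs =
  multiplicity-map-∉ _≟ΣΛ_ (tag s′) xs (λ _ eq → s≢s′ (cong proj₁ eq))

multiplicity-sidedLightenings-node : ∀ s a ms z p →
  multiplicity _≟ΣΛ_ (s , p) (sidedLightenings (node a ms z)) ≡ ⟪ p , lighteningsThrough s a ms z ⟫
multiplicity-sidedLightenings-node s a ms z p = begin
  multiplicity _≟ΣΛ_ (s , p) (sidedLightenings (node a ms z))
    ≡⟨ cong (multiplicity _≟ΣΛ_ (s , p)) (sidedLightenings-node a ms z) ⟩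
  multiplicity _≟ΣΛ_ (s , p) (tagged firstChild F ++ tagged middleChild M ++ tagged lastChild L)
    ≡⟨ multiplicity-++³ _≟ΣΛ_ (s , p) (tagged firstChild F) (tagged middleChild M) (tagged lastChild L) ⟩
  tally s firstChild F + (tally s middleChild M + tally s lastChild L)
    ≡⟨ select s ⟩
  ⟪ p , lighteningsThrough s a ms z ⟫
    ∎
  where
  F = firstLightenings a ms z
  M = middleLightenings a ms z
  L = lastLightenings a ms z
  tally : Side → Side → List Lightening → ℕ
  tally s s′ xs = multiplicity _≟ΣΛ_ (s , p) (tagged s′ xs)
  hit : ∀ s xs → tally s s xs ≡ ⟪ p , xs ⟫
  hit s = multiplicity-tagged-hit s p
  miss : ∀ {s s′} → s ≢ s′ → ∀ xs → tally s s′ xs ≡ 0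
  miss s≢s′ = multiplicity-tagged-miss s≢s′ p
  select : ∀ s → tally s firstChild F + (tally s middleChild M + tally s lastChild L) ≡ ⟪ p , lighteningsThrough s a ms z ⟫
  select firstChild  = trans (cong₂ _+_ (hit _ F) (cong₂ _+_ (miss (λ ()) M) (miss (λ ()) L))) (+-identityʳ _)
  select middleChild = trans (cong₂ _+_ (miss (λ ()) F) (cong₂ _+_ (hit _ M) (miss (λ ()) L))) (+-identityʳ _)
  select lastChild   = cong₂ _+_ (miss (λ ()) F) (cong₂ _+_ (miss (λ ()) M) (hit _ L))

map-leafIndices : ∀ {A : Set} (g : ℕ → A) t → map g (leafIndices t) ≡ applyUpTo (g ∘ suc) (leaves t)
map-leafIndices g t = trans (sym (map-∘ (upTo (leaves t)))) (map-upTo (g ∘ suc) (leaves t))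

lightCoeff≡multiplicity : ∀ t u v → lightCoeff t u v ≡ ⟪ (u , v) , lightenings t ⟫
lightCoeff≡multiplicity t u v =
  trans (length-filter-map _ (_≟Λ_ (u , v)) (lightening t)
                           (λ m → mk⇔ (λ { (refl , refl) → refl }) (λ { refl → refl , refl })) (leafIndices t))
        (cong ⟪ (u , v) ,_⟫ (map-leafIndices (lightening t) t))

lightCoeffSide≡multiplicity : ∀ s t u v → lightCoeffSide s t u v ≡ multiplicity _≟ΣΛ_ (s , u , v) (sidedLightenings t)
lightCoeffSide≡multiplicity s t u v =
  trans (length-filter-map _ (_≟ΣΛ_ (s , u , v)) (sidedLightening t)
                           (λ m → mk⇔ (λ { ((refl , refl) , refl) → refl }) (λ { refl → (refl , refl) , refl }))
                           (leafIndices t))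
        (cong (multiplicity _≟ΣΛ_ (s , u , v)) (map-leafIndices (sidedLightening t) t))

lightCoeffSide-node : ∀ s a ms z u v → lightCoeffSide s (node a ms z) u v ≡ ⟪ (u , v) , lighteningsThrough s a ms z ⟫
lightCoeffSide-node s a ms z u v =
  trans (lightCoeffSide≡multiplicity s (node a ms z) u v) (multiplicity-sidedLightenings-node s a ms z (u , v))

⋆-identityʳ : ∀ t → t ⋆ leaf ≡ t ∷ []
⋆-identityʳ leaf         = refl
⋆-identityʳ (node _ _ _) = refl

≺-node : ∀ a ms z v → node a ms z ≺ v ≡ map (node a ms) (z ⋆ v)
≺-node a ms z leaf         = cong (map (node a ms)) (sym (⋆-identityʳ z))
≺-node a ms z (node _ _ _) = refl

≻-node : ∀ u b ns w → u ≻ node b ns w ≡ map (λ s → node s ns w) (u ⋆ b)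
≻-node leaf         b ns w = refl
≻-node (node _ _ _) b ns w = refl

-- u ⋆ v = u ≺ v ++ u • v ++ u ≻ v fails only for u = v = leaf, where the extra term | has
-- coefficient 0 in a node.
⋆-coefficient-split : ∀ a ms z u v → ⟨ node a ms z , u ⋆ v ⟩ ≡ ⟨ node a ms z , u ≺ v ++ u • v ++ u ≻ v ⟩
⋆-coefficient-split a ms z leaf         leaf         = refl
⋆-coefficient-split a ms z leaf         (node _ _ _) = refl
⋆-coefficient-split a ms z (node _ _ _) leaf         = refl
⋆-coefficient-split a ms z (node _ _ _) (node _ _ _) = refl

mutual
  ⋆-coefficient : ∀ t u v → ⟨ t , u ⋆ v ⟩ ≡ ⟪ (u , v) , lightenings t ⟫
  ⋆-coefficient leaf leaf         leaf         = refl
  ⋆-coefficient leaf leaf         (node _ _ _) = refl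
  ⋆-coefficient leaf (node _ _ _) leaf         = refl
  ⋆-coefficient leaf u@(node a ms z) v@(node b ns w) =
    trans (multiplicity-++³ _≟T_ leaf (u ≺ v) (u • v) (u ≻ v))
          (cong₂ _+_ (multiplicity-map-∉ _≟T_ (node a ms) (z ⋆ v) (λ _ ()))
                     (cong₂ _+_ (multiplicity-map-∉ _≟T_ (λ s → node a (ms ++ s ∷ ns) w) (z ⋆ b) (λ _ ()))
                                (multiplicity-map-∉ _≟T_ (λ s → node s ns w) (u ⋆ b) (λ _ ()))))
  ⋆-coefficient t@(node a ms z) u v = begin
    ⟨ t , u ⋆ v ⟩
      ≡⟨ ⋆-coefficient-split a ms z u v ⟩
    ⟨ t , u ≺ v ++ u • v ++ u ≻ v ⟩
      ≡⟨ multiplicity-++³ _≟T_ t (u ≺ v) (u • v) (u ≻ v) ⟩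
    ⟨ t , u ≺ v ⟩ + (⟨ t , u • v ⟩ + ⟨ t , u ≻ v ⟩)
      ≡⟨ cong₂ _+_ (≺-coefficient a ms z u v) (cong₂ _+_ (•-coefficient a ms z u v) (≻-coefficient a ms z u v)) ⟩
    ⟪ (u , v) , L ⟫ + (⟪ (u , v) , M ⟫ + ⟪ (u , v) , F ⟫)
      ≡⟨ trans (+-comm ⟪ (u , v) , L ⟫ _) (trans (cong (_+ ⟪ (u , v) , L ⟫) (+-comm ⟪ (u , v) , M ⟫ _))
                                                (+-assoc ⟪ (u , v) , F ⟫ _ _)) ⟩
    ⟪ (u , v) , F ⟫ + (⟪ (u , v) , M ⟫ + ⟪ (u , v) , L ⟫)
      ≡⟨ sym (multiplicity-++³ _≟Λ_ (u , v) F M L) ⟩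
    ⟪ (u , v) , F ++ M ++ L ⟫
      ≡⟨ cong ⟪ (u , v) ,_⟫ (sym (lightenings-node a ms z)) ⟩
    ⟪ (u , v) , lightenings t ⟫
      ∎
    where
    F = firstLightenings a ms z
    M = middleLightenings a ms z
    L = lastLightenings a ms z

  -- Each `with` compares t with the only shape it could have inside the product;
  -- on a mismatch both sides vanish.
  ≺-coefficient : ∀ a ms z u v → ⟨ node a ms z , u ≺ v ⟩ ≡ ⟪ (u , v) , lastLightenings a ms z ⟫
  ≺-coefficient a ms z leaf v = sym (multiplicity-map-∉ _≟Λ_ (graftLast a ms) (lightenings z) (λ { (L , R) () }))
  ≺-coefficient a ms z (node a′ ms′ z′) v with node a′ ms′ z ≟T node a ms z
  ... | yes refl = begin
    ⟨ node a ms z , node a ms z′ ≺ v ⟩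
      ≡⟨ cong ⟨ node a ms z ,_⟩ (≺-node a ms z′ v) ⟩
    ⟨ node a ms z , map (node a ms) (z′ ⋆ v) ⟩
      ≡⟨ multiplicity-map-injective _≟T_ _≟T_ (λ { refl → refl }) z (z′ ⋆ v) ⟩
    ⟨ z , z′ ⋆ v ⟩
      ≡⟨ ⋆-coefficient z z′ v ⟩
    ⟪ (z′ , v) , lightenings z ⟫
      ≡⟨ sym (multiplicity-map-injective _≟Λ_ _≟Λ_ (λ { {_ , _} {_ , _} refl → refl }) (z′ , v) (lightenings z)) ⟩
    ⟪ (node a ms z′ , v) , lastLightenings a ms z ⟫
      ∎
  ... | no ne = begin
    ⟨ node a ms z , node a′ ms′ z′ ≺ v ⟩
      ≡⟨ cong ⟨ node a ms z ,_⟩ (≺-node a′ ms′ z′ v) ⟩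
    ⟨ node a ms z , map (node a′ ms′) (z′ ⋆ v) ⟩
      ≡⟨ multiplicity-map-∉ _≟T_ (node a′ ms′) (z′ ⋆ v) (λ { _ refl → ne refl }) ⟩
    0
      ≡⟨ sym (multiplicity-map-∉ _≟Λ_ (graftLast a ms) (lightenings z) (λ { (L , R) refl → ne refl })) ⟩
    ⟪ (node a′ ms′ z′ , v) , lastLightenings a ms z ⟫
      ∎

  ≻-coefficient : ∀ a ms z u v → ⟨ node a ms z , u ≻ v ⟩ ≡ ⟪ (u , v) , firstLightenings a ms z ⟫
  ≻-coefficient a ms z u leaf = sym (multiplicity-map-∉ _≟Λ_ (graftFirst ms z) (lightenings a) (λ { (L , R) () }))
  ≻-coefficient a ms z u (node b ns w) with node a ns w ≟T node a ms z
  ... | yes refl = begin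
    ⟨ node a ms z , u ≻ node b ms z ⟩
      ≡⟨ cong ⟨ node a ms z ,_⟩ (≻-node u b ms z) ⟩
    ⟨ node a ms z , map (λ s → node s ms z) (u ⋆ b) ⟩
      ≡⟨ multiplicity-map-injective _≟T_ _≟T_ (λ { refl → refl }) a (u ⋆ b) ⟩
    ⟨ a , u ⋆ b ⟩
      ≡⟨ ⋆-coefficient a u b ⟩
    ⟪ (u , b) , lightenings a ⟫
      ≡⟨ sym (multiplicity-map-injective _≟Λ_ _≟Λ_ (λ { {_ , _} {_ , _} refl → refl }) (u , b) (lightenings a)) ⟩
    ⟪ (u , node b ms z) , firstLightenings a ms z ⟫
      ∎
  ... | no ne = begin
    ⟨ node a ms z , u ≻ node b ns w ⟩
      ≡⟨ cong ⟨ node a ms z ,_⟩ (≻-node u b ns w) ⟩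
    ⟨ node a ms z , map (λ s → node s ns w) (u ⋆ b) ⟩
      ≡⟨ multiplicity-map-∉ _≟T_ (λ s → node s ns w) (u ⋆ b) (λ { _ refl → ne refl }) ⟩
    0
      ≡⟨ sym (multiplicity-map-∉ _≟Λ_ (graftFirst ms z) (lightenings a) (λ { (L , R) refl → ne refl })) ⟩
    ⟪ (u , node b ns w) , firstLightenings a ms z ⟫
      ∎

  •-coefficient : ∀ a ms z u v → ⟨ node a ms z , u • v ⟩ ≡ ⟪ (u , v) , middleLightenings a ms z ⟫
  •-coefficient a ms z leaf v =
    sym (multiplicity-∉ _≟Λ_ (All-map (λ (L≢leaf , _) eq → L≢leaf (sym (cong proj₁ eq))) (middleLightenings-nonLeaf a ms z)))
  •-coefficient a ms z (node _ _ _) leaf =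
    sym (multiplicity-∉ _≟Λ_ (All-map (λ (_ , R≢leaf) eq → R≢leaf (sym (cong proj₂ eq))) (middleLightenings-nonLeaf a ms z)))
  •-coefficient a ms z (node a′ ms′ z′) (node b ns w) = sym (middle-coefficient a z ms a′ ms′ z′ b ns w)

  middle-coefficient : ∀ a z cs a′ ms′ z′ b ns w →
    ⟪ (node a′ ms′ z′ , node b ns w) , middleLightenings a cs z ⟫
      ≡ ⟨ node a cs z , map (λ s → node a′ (ms′ ++ s ∷ ns) w) (z′ ⋆ b) ⟩
  middle-coefficient a z []       a′ []      z′ b ns w =
    sym (multiplicity-map-∉ _≟T_ (λ s → node a′ (s ∷ ns) w) (z′ ⋆ b) (λ _ ()))
  middle-coefficient a z []       a′ (q ∷ r) z′ b ns w =
    sym (multiplicity-map-∉ _≟T_ (λ s → node a′ (q ∷ r ++ s ∷ ns) w) (z′ ⋆ b) (λ _ ()))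
  middle-coefficient a z (c ∷ cs) a′ []      z′ b ns w with node a′ (c ∷ ns) w ≟T node a (c ∷ cs) z
  ... | yes refl = begin
    ⟪ (node a [] z′ , node b cs z) , middleLightenings a (c ∷ cs) z ⟫
      ≡⟨ multiplicity-++ _≟Λ_ _ (map (graftMiddle a cs z) (lightenings c)) _ ⟩
    ⟪ (node a [] z′ , node b cs z) , map (graftMiddle a cs z) (lightenings c) ⟫
      + ⟪ (node a [] z′ , node b cs z) , map (map₁ (consMiddle c)) (middleLightenings a cs z) ⟫
      ≡⟨ cong₂ _+_ (multiplicity-map-injective _≟Λ_ _≟Λ_ (λ { {_ , _} {_ , _} refl → refl }) (z′ , b) (lightenings c))
                   (multiplicity-map-∉ _≟Λ_ (map₁ (consMiddle c)) (middleLightenings a cs z)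
                      (λ { (leaf , _) () ; (node _ _ _ , _) () })) ⟩
    ⟪ (z′ , b) , lightenings c ⟫ + 0
      ≡⟨ +-identityʳ _ ⟩
    ⟪ (z′ , b) , lightenings c ⟫
      ≡⟨ sym (⋆-coefficient c z′ b) ⟩
    ⟨ c , z′ ⋆ b ⟩
      ≡⟨ sym (multiplicity-map-injective _≟T_ _≟T_ (λ { refl → refl }) c (z′ ⋆ b)) ⟩
    ⟨ node a (c ∷ cs) z , map (λ s → node a (s ∷ cs) z) (z′ ⋆ b) ⟩
      ∎
  ... | no ne =
    trans (multiplicity-++ _≟Λ_ _ (map (graftMiddle a cs z) (lightenings c)) _)
          (trans (cong₂ _+_ (multiplicity-map-∉ _≟Λ_ (graftMiddle a cs z) (lightenings c) (λ { (L , R) refl → ne refl }))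
                            (multiplicity-map-∉ _≟Λ_ (map₁ (consMiddle c)) (middleLightenings a cs z)
                               (λ { (leaf , _) () ; (node _ _ _ , _) () })))
                 (sym (multiplicity-map-∉ _≟T_ (λ s → node a′ (s ∷ ns) w) (z′ ⋆ b) (λ { _ refl → ne refl }))))
  middle-coefficient a z (c ∷ cs) a′ (q ∷ r) z′ b ns w with q ≟T c
  ... | yes refl = begin
    ⟪ (node a′ (c ∷ r) z′ , node b ns w) , middleLightenings a (c ∷ cs) z ⟫
      ≡⟨ multiplicity-++ _≟Λ_ _ (map (graftMiddle a cs z) (lightenings c)) _ ⟩
    ⟪ (node a′ (c ∷ r) z′ , node b ns w) , map (graftMiddle a cs z) (lightenings c) ⟫
      + ⟪ (node a′ (c ∷ r) z′ , node b ns w) , map (map₁ (consMiddle c)) (middleLightenings a cs z) ⟫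
      ≡⟨ cong₂ _+_ (multiplicity-map-∉ _≟Λ_ (graftMiddle a cs z) (lightenings c) (λ { (L , R) () }))
                   (multiplicity-map-injective _≟Λ_ _≟Λ_ (map₁-consMiddle-injective c)
                                               (node a′ r z′ , node b ns w) (middleLightenings a cs z)) ⟩
    ⟪ (node a′ r z′ , node b ns w) , middleLightenings a cs z ⟫
      ≡⟨ middle-coefficient a z cs a′ r z′ b ns w ⟩
    ⟨ node a cs z , map f (z′ ⋆ b) ⟩
      ≡⟨ sym (multiplicity-map-injective _≟T_ _≟T_ (consMiddle-injective c) (node a cs z) (map f (z′ ⋆ b))) ⟩
    ⟨ node a (c ∷ cs) z , map (consMiddle c) (map f (z′ ⋆ b)) ⟩
      ≡⟨ cong ⟨ node a (c ∷ cs) z ,_⟩ (sym (map-∘ (z′ ⋆ b))) ⟩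
    ⟨ node a (c ∷ cs) z , map (λ s → node a′ (c ∷ r ++ s ∷ ns) w) (z′ ⋆ b) ⟩
      ∎
    where
    f : Tree → Tree
    f s = node a′ (r ++ s ∷ ns) w
  ... | no q≢c =
    trans (multiplicity-++ _≟Λ_ _ (map (graftMiddle a cs z) (lightenings c)) _)
          (trans (cong₂ _+_ (multiplicity-map-∉ _≟Λ_ (graftMiddle a cs z) (lightenings c) (λ { (L , R) () }))
                            (multiplicity-map-∉ _≟Λ_ (map₁ (consMiddle c)) (middleLightenings a cs z)
                               (λ { (leaf , _) () ; (node _ _ _ , _) refl → q≢c refl })))
                 (sym (multiplicity-map-∉ _≟T_ (λ s → node a′ (q ∷ r ++ s ∷ ns) w) (z′ ⋆ b)
                                          (λ { _ refl → q≢c refl }))))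

mainTheorem11 : (t : Tree) → t ≢ leaf →
    ((u v : Tree) → ⟨ t , u ⋆ v ⟩ ≡ lightCoeff t u v)
    × ((u v : Tree) → ¬ (u ≡ leaf × v ≡ leaf) → ⟨ t , u ≺ v ⟩ ≡ lightCoeffSide lastChild t u v)
    × ((u v : Tree) → ¬ (u ≡ leaf × v ≡ leaf) → ⟨ t , u ≻ v ⟩ ≡ lightCoeffSide firstChild t u v)
    × ((u v : Tree) → ¬ (u ≡ leaf × v ≡ leaf) → ⟨ t , u • v ⟩ ≡ lightCoeffSide middleChild t u v)
-- The side identities hold for u = v = leaf as well (both sides vanish), so that hypothesis is unused.
mainTheorem11 leaf t≢leaf = ⊥-elim (t≢leaf refl)
mainTheorem11 t@(node a ms z) _ =
    (λ u v → trans (⋆-coefficient t u v) (sym (lightCoeff≡multiplicity t u v)))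
  , (λ u v _ → trans (≺-coefficient a ms z u v) (sym (lightCoeffSide-node lastChild a ms z u v)))
  , (λ u v _ → trans (≻-coefficient a ms z u v) (sym (lightCoeffSide-node firstChild a ms z u v)))
  , (λ u v _ → trans (•-coefficient a ms z u v) (sym (lightCoeffSide-node middleChild a ms z u v)))
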